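{- For $n\ge 5$, the number of positions of \textsc{Snort} played on the cycle $C_n$ satisfies \[P_{\textsc{Snort},C_n}(1,1)=P_{\textsc{Snort},P_{n-1}}(1,1)+3P_{\textsc{Snort},P_{n-3}}(1,1)+2P_{\textsc{Snort},P_{n-4}}(1,1)+P_{\textsc{Snort},C_{n-2}}(1,1).\]
   Context: A distance game given by a pair of sets $(S,D)$ of positive integers is played on a finite graph by two players, Left (colouring vertices blue) and Right (colouring vertices red). A position is any assignment to a subset of the vertices of the colours blue or red (other vertices empty) such that no two vertices of the same colour are at graph distance in $S$ and no two vertices of different colours are at graph distance in $D$; no assumption of alternating play is made. \textsc{Snort} is the distance game with $S=\emptyset$, $D=\{1\}$ (no two adjacent vertices of different colours). $P_{G,B}(1,1)$ denotes the total number of positions of game $G$ on board $B$. $P_m$ is the path and $C_m$ the cycle with $m$ vertices ($P_0$ has one position). -}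

module Defs where

open import Data.Nat using (ℕ; zero; suc; _+_; _∸_)
open import Data.Nat.Properties using (_≟_)
open import Data.Fin using (Fin; toℕ)
open import Data.Vec using (Vec; []; _∷_; lookup)
open import Data.List using (List; []; _∷_; concatMap; map; filter; length)
open import Data.Product using (_×_)
open import Data.Sum using (_⊎_)
open import Data.Empty using (⊥)
open import Data.Unit using (⊤; tt)
open import Relation.Nullary using (¬_; Dec; yes; no)
open import Relation.Nullary.Decidable using (¬?; _⊎-dec_; _×-dec_)
open import Data.Fin.Properties using (all?)
open import Relation.Binary.PropositionalEquality using (_≡_)

record Graph (m : ℕ) : Set₁ where
  field
    Adj  : Fin m → Fin m → Set
    adj? : (i j : Fin m) → Dec (Adj i j)
open Graph public

-- State of a vertex in a position: empty, blue (Left) or red (Right).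
data Cell : Set where
  empty blue red : Cell

DiffColour : Cell → Cell → Set
DiffColour blue red = ⊤
DiffColour red blue = ⊤
DiffColour _ _ = ⊥

diffColour? : (a b : Cell) → Dec (DiffColour a b)
diffColour? empty empty = no λ ()
diffColour? empty blue = no λ ()
diffColour? empty red = no λ ()
diffColour? blue empty = no λ ()
diffColour? blue blue = no λ ()
diffColour? blue red = yes tt
diffColour? red empty = no λ ()
diffColour? red blue = yes tt
diffColour? red red = no λ ()

assignments : (m : ℕ) → List (Vec Cell m)
assignments zero = [] ∷ []
assignments (suc m) =
  concatMap (λ v → (empty ∷ v) ∷ (blue ∷ v) ∷ (red ∷ v) ∷ []) (assignments m)

-- Snort position: S = ∅, D = {1}: no two vertices of different colours
-- at distance 1 (i.e. adjacent).
IsSnortPosition : {m : ℕ} → Graph m → Vec Cell m → Set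
IsSnortPosition {m} G c =
  (i j : Fin m) → Adj G i j → ¬ DiffColour (lookup c i) (lookup c j)

isSnortPosition? : {m : ℕ} (G : Graph m) (c : Vec Cell m) → Dec (IsSnortPosition G c)
isSnortPosition? G c =
  all? λ i → all? λ j → helper i j
  where
    helper : ∀ i j → Dec (Adj G i j → ¬ DiffColour (lookup c i) (lookup c j))
    helper i j with adj? G i j | diffColour? (lookup c i) (lookup c j)
    ... | no ¬a | _ = yes λ a → λ _ → ¬a a
    ... | yes _ | no ¬d = yes λ _ → ¬d
    ... | yes a | yes d = no λ f → f a d

-- P_{Snort,G}(1,1): total number of Snort positions on G.
snortPositions : {m : ℕ} → Graph m → ℕ
snortPositions G = length (filter (isSnortPosition? G) (assignments _))

pathGraph : (m : ℕ) → Graph m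
pathGraph m = record
  { Adj  = λ i j → (suc (toℕ i) ≡ toℕ j) ⊎ (suc (toℕ j) ≡ toℕ i)
  ; adj? = λ i j → (suc (toℕ i) ≟ toℕ j) ⊎-dec (suc (toℕ j) ≟ toℕ i)
  }

cycleGraph : (m : ℕ) → Graph m
cycleGraph m = record
  { Adj  = λ i j → ((suc (toℕ i) ≡ toℕ j) ⊎ (suc (toℕ j) ≡ toℕ i))
                   ⊎ (((toℕ i ≡ 0) × (suc (toℕ j) ≡ m))
                      ⊎ ((toℕ j ≡ 0) × (suc (toℕ i) ≡ m)))
  ; adj? = λ i j → ((suc (toℕ i) ≟ toℕ j) ⊎-dec (suc (toℕ j) ≟ toℕ i))
                   ⊎-dec (((toℕ i ≟ 0) ×-dec (suc (toℕ j) ≟ m))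
                      ⊎-dec ((toℕ j ≟ 0) ×-dec (suc (toℕ i) ≟ m)))
  }

-- Reading a position on P_{m+1} or C_{m+1} vertex by vertex, each cell only has to be
-- compatible with its predecessor (and, on the cycle, the last one with the first), so
-- positions are counted by powers of the 3 × 3 transfer matrix T = [[1,1,1],[1,1,0],[1,0,1]].
-- Its characteristic polynomial is λ³ - 3λ² + λ + 1, hence by Cayley–Hamilton both sides of
-- the identity, as functions of n, satisfy s(k+3) + s(k+1) + s(k) = 3 s(k+2); they agree for
-- n = 5, 6, 7, and so for all n ≥ 5.
module Submission where

open import Defs
open import Algebra.Properties.CommutativeSemigroup as +-Semigroup using ()
open import Algebra.Properties.CommutativeSemigroup as *-Semigroup using ()
open import Data.Bool using (Bool; true; false; _∧_; T; if_then_else_)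
open import Data.Bool.Properties using (T-∧)
open import Data.Fin using (zero; suc; toℕ; fromℕ)
open import Data.Fin.Properties using (toℕ-fromℕ; toℕ-injective)
open import Data.List using (List; []; _∷_; concatMap; filter; length)
open import Data.Nat using (ℕ; zero; suc; _+_; _*_; _∸_; _≥_; s≤s; z≤n)
open import Data.Nat.Properties
  using (+-identityʳ; +-suc; +-cancelʳ-≡; suc-injective; *-distribˡ-+;
         +-commutativeSemigroup; *-commutativeSemigroup)
open import Data.Nat.Solver using (module +-*-Solver)
open import Data.Nat.Tactic.RingSolver using (solve-∀)
open import Data.Product using (_×_; _,_; proj₁; proj₂)
open import Data.Sum using (inj₁; inj₂; map)
open import Data.Unit using (tt)
open import Data.Vec using (Vec; []; _∷_; lookup)
open import Function using (_∘_; const; _⇔_; mk⇔; Equivalence)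
open import Relation.Nullary using (¬_; Dec; yes; no; does; ¬?)
open import Relation.Nullary.Decidable using (dec-true; dec-false)
open import Relation.Unary using (Decidable)
open import Relation.Binary.PropositionalEquality

open Equivalence using (to; from)
open +-Semigroup +-commutativeSemigroup using (interchange)
open *-Semigroup *-commutativeSemigroup using (x∙yz≈y∙xz)

indicator : Bool → ℕ
indicator b = if b then 1 else 0

count : {A : Set} → (A → Bool) → List A → ℕ
count p []       = 0
count p (x ∷ xs) = indicator (p x) + count p xs

length-filter : {A : Set} {P : A → Set} (P? : Decidable P) (xs : List A) →
  length (filter P? xs) ≡ count (does ∘ P?) xs
length-filter P? [] = refl
length-filter P? (x ∷ xs) with does (P? x)
... | true  = cong suc (length-filter P? xs)
... | false = length-filter P? xs

count-cong : {A : Set} {p q : A → Bool} → (∀ x → p x ≡ q x) → (xs : List A) →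
  count p xs ≡ count q xs
count-cong p≗q []       = refl
count-cong p≗q (x ∷ xs) = cong₂ _+_ (cong indicator (p≗q x)) (count-cong p≗q xs)

count-false : {A : Set} (xs : List A) → count (λ _ → false) xs ≡ 0
count-false []       = refl
count-false (x ∷ xs) = count-false xs

does-⇔ : {P : Set} {b : Bool} (P? : Dec P) → P ⇔ T b → does P? ≡ b
does-⇔ {b = true}  P? P⇔T = dec-true P? (from P⇔T tt)
does-⇔ {b = false} P? P⇔T = dec-false P? (to P⇔T)

sumCells : (Cell → ℕ) → ℕ
sumCells f = f empty + f blue + f red

sumCells-cong : {f g : Cell → ℕ} → (∀ x → f x ≡ g x) → sumCells f ≡ sumCells g
sumCells-cong f≗g = cong₂ _+_ (cong₂ _+_ (f≗g empty) (f≗g blue)) (f≗g red)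

count-assignments-suc : ∀ m (p : Vec Cell (suc m) → Bool) →
  count p (assignments (suc m)) ≡ sumCells (λ x → count (p ∘ (x ∷_)) (assignments m))
count-assignments-suc m p = go (assignments m)
  where
  shuffle : ∀ a b c x y z → a + (b + (c + (x + y + z))) ≡ a + x + (b + y) + (c + z)
  shuffle = solve-∀

  go : (vs : List (Vec Cell m)) →
    count p (concatMap (λ v → (empty ∷ v) ∷ (blue ∷ v) ∷ (red ∷ v) ∷ []) vs)
      ≡ sumCells (λ x → count (p ∘ (x ∷_)) vs)
  go []       = refl
  go (v ∷ vs) = trans (cong (λ rest → ind empty + (ind blue + (ind red + rest))) (go vs))
                      (shuffle (ind empty) (ind blue) (ind red) _ _ _)
    where
    ind : Cell → ℕ
    ind x = indicator (p (x ∷ v))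

compatible : Cell → Cell → Bool
compatible x y = does (¬? (diffColour? x y))

compatible-⇔ : ∀ x y → T (compatible x y) ⇔ (¬ DiffColour x y)
compatible-⇔ x y with diffColour? x y
... | yes d = mk⇔ (λ ()) (λ ¬d → ¬d d)
... | no ¬d = mk⇔ (const ¬d) (const tt)

diffColour-sym : ∀ x y → DiffColour x y → DiffColour y x
diffColour-sym blue red _ = tt
diffColour-sym red blue _ = tt

chain : ∀ {m} → (Cell → Bool) → Cell → Vec Cell m → Bool
chain e x []      = e x
chain e x (y ∷ v) = compatible x y ∧ chain e y v

snortPath-singleton : ∀ x → IsSnortPosition (pathGraph 1) (x ∷ [])
snortPath-singleton x zero zero (inj₁ ())
snortPath-singleton x zero zero (inj₂ ())

snortPath-∷ : ∀ {m} x y (v : Vec Cell m) →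
  IsSnortPosition (pathGraph (2 + m)) (x ∷ y ∷ v)
    ⇔ (¬ DiffColour x y × IsSnortPosition (pathGraph (suc m)) (y ∷ v))
snortPath-∷ {m} x y v = mk⇔
  (λ h → h zero (suc zero) (inj₁ refl) ,
         λ i j a → h (suc i) (suc j) (map (cong suc) (cong suc) a))
  (λ (c , h) → glue c h)
  where
  glue : ¬ DiffColour x y → IsSnortPosition (pathGraph (suc m)) (y ∷ v) →
    IsSnortPosition (pathGraph (2 + m)) (x ∷ y ∷ v)
  glue c h zero zero (inj₁ ())
  glue c h zero zero (inj₂ ())
  glue c h zero (suc zero) _ = c
  glue c h zero (suc (suc j)) (inj₁ ())
  glue c h zero (suc (suc j)) (inj₂ ())
  glue c h (suc zero) zero _ = c ∘ diffColour-sym _ _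
  glue c h (suc (suc i)) zero (inj₁ ())
  glue c h (suc (suc i)) zero (inj₂ ())
  glue c h (suc i) (suc j) a = h i j (map suc-injective suc-injective a)

chain-⇔ : ∀ {m} e x (v : Vec Cell m) →
  T (chain e x v) ⇔ (IsSnortPosition (pathGraph (suc m)) (x ∷ v) × T (e (lookup (x ∷ v) (fromℕ m))))
chain-⇔ e x [] = mk⇔ (snortPath-singleton x ,_) proj₂
chain-⇔ e x (y ∷ v) = mk⇔
  (λ t → let (c , t′) = to T-∧ t ; (h , ev) = to (chain-⇔ e y v) t′
         in from (snortPath-∷ x y v) (to (compatible-⇔ x y) c , h) , ev)
  (λ (h , ev) → let (c , h′) = to (snortPath-∷ x y v) h
                in from T-∧ (from (compatible-⇔ x y) c , from (chain-⇔ e y v) (h′ , ev)))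

snortCycle-⇔ : ∀ {m} (c : Vec Cell (suc m)) →
  IsSnortPosition (cycleGraph (suc m)) c
    ⇔ (IsSnortPosition (pathGraph (suc m)) c × ¬ DiffColour (lookup c (fromℕ m)) (lookup c zero))
snortCycle-⇔ {m} c = mk⇔
  (λ h → (λ i j a → h i j (inj₁ a)) ,
         h (fromℕ m) zero (inj₂ (inj₂ (refl , cong suc (toℕ-fromℕ m)))))
  (λ (h , w) → close h w)
  where
  isLast : ∀ {j} → suc (toℕ j) ≡ suc m → j ≡ fromℕ m
  isLast e = toℕ-injective (trans (suc-injective e) (sym (toℕ-fromℕ m)))

  close : IsSnortPosition (pathGraph (suc m)) c → ¬ DiffColour (lookup c (fromℕ m)) (lookup c zero) →
    IsSnortPosition (cycleGraph (suc m)) c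
  close h w i j (inj₁ a) = h i j a
  close h w zero j (inj₂ (inj₁ (_ , e))) rewrite isLast e = w ∘ diffColour-sym _ _
  close h w (suc i) j (inj₂ (inj₁ (() , _)))
  close h w i zero (inj₂ (inj₂ (_ , e))) rewrite isLast e = w
  close h w i (suc j) (inj₂ (inj₂ (() , _)))

snortPath-does : ∀ {m} x (v : Vec Cell m) →
  does (isSnortPosition? (pathGraph (suc m)) (x ∷ v)) ≡ chain (const true) x v
snortPath-does x v = does-⇔ (isSnortPosition? _ (x ∷ v))
  (mk⇔ (λ h → from (chain-⇔ _ x v) (h , tt)) (proj₁ ∘ to (chain-⇔ _ x v)))

snortCycle-does : ∀ {m} x (v : Vec Cell m) →
  does (isSnortPosition? (cycleGraph (suc m)) (x ∷ v)) ≡ chain (λ z → compatible z x) x v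
snortCycle-does {m} x v = does-⇔ (isSnortPosition? _ (x ∷ v)) (mk⇔
  (λ h → let (p , w) = to (snortCycle-⇔ (x ∷ v)) h
         in from (chain-⇔ _ x v) (p , from (compatible-⇔ (lookup (x ∷ v) (fromℕ m)) x) w))
  (λ t → let (p , w) = to (chain-⇔ _ x v) t
         in from (snortCycle-⇔ (x ∷ v)) (p , to (compatible-⇔ _ x) w)))

-- Defined over an arbitrary addition so that the ring solver can read it symbolically.
transferWith : {A : Set} → (A → A → A) → (Cell → A) → Cell → A
transferWith _⊕_ w empty = (w empty ⊕ w blue) ⊕ w red
transferWith _⊕_ w blue  = w empty ⊕ w blue
transferWith _⊕_ w red   = w empty ⊕ w red

transfer^ : ℕ → (Cell → ℕ) → Cell → ℕ
transfer^ zero    w = w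
transfer^ (suc k) w = transferWith _+_ (transfer^ k w)

count-chain : ∀ m e x → count (chain e x) (assignments m) ≡ transfer^ m (indicator ∘ e) x
count-chain zero e x = +-identityʳ _
count-chain (suc m) e x = trans (count-assignments-suc m (chain e x)) (step x)
  where
  ih : ∀ y → count (chain e y) (assignments m) ≡ transfer^ m (indicator ∘ e) y
  ih = count-chain m e

  step : ∀ x → sumCells (λ y → count (chain e x ∘ (y ∷_)) (assignments m))
               ≡ transfer^ (suc m) (indicator ∘ e) x
  step empty = sumCells-cong ih
  step blue  = trans (cong₂ _+_ (cong₂ _+_ (ih empty) (ih blue)) (count-false (assignments m)))
                     (+-identityʳ (transfer^ (suc m) (indicator ∘ e) blue))
  step red   = trans (cong₂ _+_ (cong₂ _+_ (ih empty) (count-false (assignments m))) (ih red))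
                     (cong (_+ transfer^ m (indicator ∘ e) red)
                           (+-identityʳ (transfer^ m (indicator ∘ e) empty)))

openChains : ℕ → ℕ
openChains m = sumCells (transfer^ m (const 1))

closedChains : ℕ → ℕ
closedChains m = sumCells (λ x → transfer^ m (λ z → indicator (compatible z x)) x)

snortPositions-suc : ∀ {m} (G : Graph (suc m)) →
  snortPositions G ≡ sumCells (λ x → count (λ v → does (isSnortPosition? G (x ∷ v))) (assignments m))
snortPositions-suc {m} G = trans (length-filter (isSnortPosition? G) (assignments (suc m)))
                                (count-assignments-suc m (does ∘ isSnortPosition? G))

snortPositions-path : ∀ m → snortPositions (pathGraph (suc m)) ≡ openChains m
snortPositions-path m = trans (snortPositions-suc (pathGraph (suc m))) (sumCells-cong λ x →
  trans (count-cong (snortPath-does x) (assignments m)) (count-chain m (const true) x))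

snortPositions-cycle : ∀ m → snortPositions (cycleGraph (suc m)) ≡ closedChains m
snortPositions-cycle m = trans (snortPositions-suc (cycleGraph (suc m))) (sumCells-cong λ x →
  trans (count-cong (snortCycle-does x) (assignments m)) (count-chain m (λ z → compatible z x) x))

record Recurrent (s : ℕ → ℕ) : Set where
  constructor recurrent
  field
    recurrence : ∀ k → s (3 + k) + (s (1 + k) + s k) ≡ 3 * s (2 + k)
open Recurrent

transfer-cayleyHamilton : ∀ w x →
  transfer^ 3 w x + (transfer^ 1 w x + w x) ≡ 3 * transfer^ 2 w x
transfer-cayleyHamilton w x = byCell x
  where
  open +-*-Solver

  cells : Polynomial 3 → Polynomial 3 → Polynomial 3 → Cell → Polynomial 3
  cells e b r empty = e
  cells e b r blue  = b
  cells e b r red   = r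

  M : (Cell → Polynomial 3) → Cell → Polynomial 3
  M = transferWith _:+_

  identity : Cell → Polynomial 3 → Polynomial 3 → Polynomial 3 → Polynomial 3 × Polynomial 3
  identity x e b r = let v = cells e b r in M (M (M v)) x :+ (M v x :+ v x) := con 3 :* M (M v) x

  byCell : ∀ x → transfer^ 3 w x + (transfer^ 1 w x + w x) ≡ 3 * transfer^ 2 w x
  byCell empty = solve 3 (identity empty) refl (w empty) (w blue) (w red)
  byCell blue  = solve 3 (identity blue) refl (w empty) (w blue) (w red)
  byCell red   = solve 3 (identity red) refl (w empty) (w blue) (w red)

transfer^-recurrent : ∀ w x → Recurrent (λ k → transfer^ k w x)
transfer^-recurrent w x = recurrent λ k → transfer-cayleyHamilton (transfer^ k w) x

Recurrent-+ : ∀ {s u} → Recurrent s → Recurrent u → Recurrent (λ k → s k + u k)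
Recurrent-+ {s} {u} rs ru = recurrent λ k → begin
  (s (3 + k) + u (3 + k)) + ((s (1 + k) + u (1 + k)) + (s k + u k))
    ≡⟨ cong (s (3 + k) + u (3 + k) +_) (interchange (s (1 + k)) (u (1 + k)) (s k) (u k)) ⟩
  (s (3 + k) + u (3 + k)) + ((s (1 + k) + s k) + (u (1 + k) + u k))
    ≡⟨ interchange (s (3 + k)) (u (3 + k)) _ _ ⟩
  (s (3 + k) + (s (1 + k) + s k)) + (u (3 + k) + (u (1 + k) + u k))
    ≡⟨ cong₂ _+_ (recurrence rs k) (recurrence ru k) ⟩
  3 * s (2 + k) + 3 * u (2 + k)
    ≡⟨ *-distribˡ-+ 3 (s (2 + k)) (u (2 + k)) ⟨
  3 * (s (2 + k) + u (2 + k)) ∎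
  where open ≡-Reasoning

Recurrent-* : ∀ c {s} → Recurrent s → Recurrent (λ k → c * s k)
Recurrent-* c {s} rs = recurrent λ k → begin
  c * s (3 + k) + (c * s (1 + k) + c * s k)
    ≡⟨ cong (c * s (3 + k) +_) (*-distribˡ-+ c (s (1 + k)) (s k)) ⟨
  c * s (3 + k) + c * (s (1 + k) + s k)
    ≡⟨ *-distribˡ-+ c (s (3 + k)) _ ⟨
  c * (s (3 + k) + (s (1 + k) + s k))
    ≡⟨ cong (c *_) (recurrence rs k) ⟩
  c * (3 * s (2 + k))
    ≡⟨ x∙yz≈y∙xz c 3 (s (2 + k)) ⟩
  3 * (c * s (2 + k)) ∎
  where open ≡-Reasoning

Recurrent-shift : ∀ {s} → Recurrent s → ∀ j → Recurrent (λ k → s (j + k))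
Recurrent-shift {s} rs j = recurrent shifted
  where
  shifted : ∀ k → s (j + (3 + k)) + (s (j + (1 + k)) + s (j + k)) ≡ 3 * s (j + (2 + k))
  shifted k rewrite +-suc j (2 + k) | +-suc j (1 + k) | +-suc j k = recurrence rs (j + k)

Recurrent-sumCells : (f : Cell → ℕ → ℕ) → (∀ x → Recurrent (f x)) →
  Recurrent (λ k → sumCells (λ x → f x k))
Recurrent-sumCells f rf = Recurrent-+ (Recurrent-+ (rf empty) (rf blue)) (rf red)

Recurrent-unique : ∀ {s u} → Recurrent s → Recurrent u →
  s 0 ≡ u 0 → s 1 ≡ u 1 → s 2 ≡ u 2 → ∀ k → s k ≡ u k
Recurrent-unique {s} {u} rs ru e₀ e₁ e₂ k = proj₁ (agree k)
  where
  agree : ∀ k → s k ≡ u k × s (1 + k) ≡ u (1 + k) × s (2 + k) ≡ u (2 + k)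
  agree zero = e₀ , e₁ , e₂
  agree (suc k) =
    let (eₖ , eₖ₊₁ , eₖ₊₂) = agree k
    in eₖ₊₁ , eₖ₊₂ , +-cancelʳ-≡ (s (1 + k) + s k) (s (3 + k)) (u (3 + k)) (begin
      s (3 + k) + (s (1 + k) + s k) ≡⟨ recurrence rs k ⟩
      3 * s (2 + k)                 ≡⟨ cong (3 *_) eₖ₊₂ ⟩
      3 * u (2 + k)                 ≡⟨ recurrence ru k ⟨
      u (3 + k) + (u (1 + k) + u k) ≡⟨ cong₂ (λ a b → u (3 + k) + (a + b)) eₖ₊₁ eₖ ⟨
      u (3 + k) + (s (1 + k) + s k) ∎)
    where open ≡-Reasoning

openChains-recurrent : Recurrent openChains
openChains-recurrent = Recurrent-sumCells _ (transfer^-recurrent (const 1))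

closedChains-recurrent : Recurrent closedChains
closedChains-recurrent =
  Recurrent-sumCells _ (λ x → transfer^-recurrent (λ z → indicator (compatible z x)) x)

mainTheorem9 : (n : ℕ) → n ≥ 5 →
    snortPositions (cycleGraph n)
      ≡ snortPositions (pathGraph (n ∸ 1)) + 3 * snortPositions (pathGraph (n ∸ 3))
        + 2 * snortPositions (pathGraph (n ∸ 4)) + snortPositions (cycleGraph (n ∸ 2))
mainTheorem9 _ (s≤s (s≤s (s≤s (s≤s (s≤s {n = k} z≤n))))) = begin
  snortPositions (cycleGraph (5 + k))  ≡⟨ snortPositions-cycle (4 + k) ⟩
  closedChains (4 + k)
    ≡⟨ Recurrent-unique (Recurrent-shift closedChains-recurrent 4) rhs-recurrent refl refl refl k ⟩
  rhs k
    ≡⟨ cong₂ _+_ (cong₂ _+_ (cong₂ _+_ (snortPositions-path (3 + k))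
                                        (cong (3 *_) (snortPositions-path (1 + k))))
                             (cong (2 *_) (snortPositions-path k)))
                 (snortPositions-cycle (2 + k)) ⟨
  snortPositions (pathGraph (4 + k)) + 3 * snortPositions (pathGraph (2 + k))
    + 2 * snortPositions (pathGraph (1 + k)) + snortPositions (cycleGraph (3 + k)) ∎
  where
  open ≡-Reasoning

  rhs : ℕ → ℕ
  rhs k = openChains (3 + k) + 3 * openChains (1 + k) + 2 * openChains k + closedChains (2 + k)

  rhs-recurrent : Recurrent rhs
  rhs-recurrent =
    Recurrent-+ (Recurrent-+ (Recurrent-+ (Recurrent-shift openChains-recurrent 3)
                                          (Recurrent-* 3 (Recurrent-shift openChains-recurrent 1)))
                             (Recurrent-* 2 openChains-recurrent))
                (Recurrent-shift closedChains-recurrent 2)
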